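{- Let $\widetilde{\mathbb{F}}$ be a field. There exists an SD-map $f:\mathbb{F}_5\to\widetilde{\mathbb{F}}$ if and only if $\widetilde{\mathbb{F}}$ contains a primitive fourth root of unity.
   Context: $\mathbb{F}_5$ is the field with five elements. For fields $\mathbb{F},\widetilde{\mathbb{F}}$, a map $f:\mathbb{F}\to\widetilde{\mathbb{F}}$ is an SD-map if for all $x\neq y$ in $\mathbb{F}$ we have $f(x)\neq f(y)$ and $f\left(\frac{x+y}{x-y}\right)=\frac{f(x)+f(y)}{f(x)-f(y)}$. -}

module Defs where

open import Level using (Level; _⊔_) renaming (suc to lsuc)
open import Data.Nat as ℕ using (ℕ; _∸_)
open import Data.Nat.DivMod using (_mod_)
open import Data.Fin using (Fin; toℕ; zero; suc)
open import Data.Product using (_×_; ∃)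
open import Relation.Nullary using (¬_)
open import Relation.Binary.PropositionalEquality using (_≢_)
open import Algebra.Bundles using (CommutativeRing)
import Algebra.Bundles
import Algebra.Definitions.RawSemiring as RawSemiringDefs

-- The inverse is
-- given as a total operation _⁻¹ (its value at 0 is irrelevant).

record Field (c ℓ : Level) : Set (lsuc (c ⊔ ℓ)) where
  field
    commutativeRing : CommutativeRing c ℓ
  open CommutativeRing commutativeRing public
  field
    _⁻¹      : Carrier → Carrier
    0≉1      : ¬ (0# ≈ 1#)
    ⁻¹-inverseʳ : ∀ x → ¬ (x ≈ 0#) → x * (x ⁻¹) ≈ 1#

  _/_ : Carrier → Carrier → Carrier
  x / y = x * (y ⁻¹)

  open RawSemiringDefs (Algebra.Bundles.Semiring.rawSemiring semiring) public using (_^_)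

𝔽₅ : Set
𝔽₅ = Fin 5

infixl 6 _+₅_ _-₅_
infixl 7 _*₅_ _/₅_

_+₅_ : 𝔽₅ → 𝔽₅ → 𝔽₅
x +₅ y = (toℕ x ℕ.+ toℕ y) mod 5

_-₅_ : 𝔽₅ → 𝔽₅ → 𝔽₅
x -₅ y = (toℕ x ℕ.+ (5 ∸ toℕ y)) mod 5

_*₅_ : 𝔽₅ → 𝔽₅ → 𝔽₅
x *₅ y = (toℕ x ℕ.* toℕ y) mod 5

-- multiplicative inverse in 𝔽₅ (0 ↦ 0 by convention; never used at 0)
inv₅ : 𝔽₅ → 𝔽₅
inv₅ zero = zero
inv₅ (suc zero) = suc zero
inv₅ (suc (suc zero)) = suc (suc (suc zero))
inv₅ (suc (suc (suc zero))) = suc (suc zero)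
inv₅ (suc (suc (suc (suc zero)))) = suc (suc (suc (suc zero)))

_/₅_ : 𝔽₅ → 𝔽₅ → 𝔽₅
x /₅ y = x *₅ inv₅ y

module _ {c ℓ} (F : Field c ℓ) where
  open Field F

  IsSDMap : (𝔽₅ → Carrier) → Set ℓ
  IsSDMap f = ∀ (x y : 𝔽₅) → x ≢ y →
    (¬ (f x ≈ f y)) ×
    (f ((x +₅ y) /₅ (x -₅ y)) ≈ (f x + f y) / (f x - f y))

  IsPrimitive4thRoot : Carrier → Set ℓ
  IsPrimitive4thRoot ζ =
    (ζ ^ 4 ≈ 1#) × (∀ (k : ℕ) → 0 ℕ.< k → k ℕ.< 4 → ¬ (ζ ^ k ≈ 1#))

  HasPrimitive4thRoot : Set (c ⊔ ℓ)
  HasPrimitive4thRoot = ∃ λ ζ → IsPrimitive4thRoot ζ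

  HasSDMap : Set (c ⊔ ℓ)
  HasSDMap = ∃ λ (f : 𝔽₅ → Carrier) → IsSDMap f

{-# OPTIONS --safe #-}
-- Clearing denominators, an SD-map f satisfies f((x+y)/(x-y)) (f x - f y) = f x + f y for x ≠ y.
-- The instances (1,0) and (2,0) differ by (f 1 - f 2)(f 1 - 1), so f 1 = 1, and then the instance
-- (1,2) reads f 2 ² = -1. The instances (0,1) and (1,0) give f 4 = -f 1, which by injectivity rules
-- out characteristic 2; so f 2 is a primitive fourth root of unity. Conversely, for such a root i the
-- quartic character 0 ↦ 0, 2ᵏ ↦ iᵏ of 𝔽₅ satisfies the cleared equations, and these already force
-- injectivity: f x = f y with x ≠ y would give 2 f x = 0, while f vanishes only at 0.
module Submission where

open import Defs
open import Algebra.Bundles using (Ring; CommutativeRing; RawRing)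
open import Algebra.Solver.Ring.AlmostCommutativeRing
  using (_-Raw-AlmostCommutative⟶_; fromCommutativeRing)
open import Data.Fin.Base using (zero; suc)
open import Data.Maybe.Base using (Maybe; just; nothing)
open import Data.Nat.Base as ℕ using (ℕ; zero; suc; s≤s; z≤n)
import Data.Nat.Properties as ℕ
open import Data.Product.Base using (_×_; _,_; proj₁; uncurry)
open import Function.Bundles using (_⇔_; mk⇔; Equivalence)
open import Relation.Binary.PropositionalEquality.Core as ≡ using (_≡_; _≢_; cong₂)
open import Relation.Nullary.Decidable.Core using (yes; no)
open import Relation.Nullary.Negation.Core using (¬_; contradiction)

module IntegerCoefficients {c ℓ} (R : CommutativeRing c ℓ) where
  open CommutativeRing R
  open import Algebra.Properties.Ring ring
    using (⁻¹-anti-homo‿-; x[y-z]≈xy-xz; [y-z]x≈yx-zx; -‿+-comm; -0#≈0#)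
  open import Algebra.Properties.CommutativeSemigroup +-commutativeSemigroup
    using (interchange)
  open import Algebra.Properties.Semiring.Mult.TCOptimised semiring
    using (×-homo-+; ×1-homo-*) renaming (_×_ to _·_)
  open import Relation.Binary.Reasoning.Setoid setoid

  private
    infix 8 _⊝_

    _⊝_ : ℕ → ℕ → Carrier
    m ⊝ n = m · 1# - n · 1#

    -‿interchange : ∀ w x y z → (w - x) + (y - z) ≈ (w + y) - (x + z)
    -‿interchange w x y z = trans (interchange w (- x) y (- z)) (+-congˡ (-‿+-comm x z))

    ⊝-+-cancelʳ : ∀ m n k → (m ℕ.+ k) ⊝ (n ℕ.+ k) ≈ m ⊝ n
    ⊝-+-cancelʳ m n k = begin
      (m ℕ.+ k) ⊝ (n ℕ.+ k)                    ≈⟨ +-cong (×-homo-+ 1# m k) (-‿cong (×-homo-+ 1# n k)) ⟩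
      (m · 1# + k · 1#) - (n · 1# + k · 1#)    ≈⟨ -‿interchange _ _ _ _ ⟨
      m ⊝ n + (k · 1# - k · 1#)                ≈⟨ +-congˡ (-‿inverseʳ (k · 1#)) ⟩
      m ⊝ n + 0#                               ≈⟨ +-identityʳ (m ⊝ n) ⟩
      m ⊝ n                                    ∎

    ⊝-cong : ∀ a b c d → a ℕ.+ d ≡ c ℕ.+ b → a ⊝ b ≈ c ⊝ d
    ⊝-cong a b c d a+d≡c+b = begin
      a ⊝ b                   ≈⟨ ⊝-+-cancelʳ a b d ⟨
      (a ℕ.+ d) ⊝ (b ℕ.+ d)   ≡⟨ cong₂ _⊝_ a+d≡c+b (ℕ.+-comm b d) ⟩
      (c ℕ.+ b) ⊝ (d ℕ.+ b)   ≈⟨ ⊝-+-cancelʳ c d b ⟩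
      c ⊝ d                   ∎

    normalise : ℕ × ℕ → ℕ × ℕ
    normalise (suc a , suc b) = normalise (a , b)
    normalise p               = p

    -- (a , b) stands for a - b; normalise makes the representation unique, as the solver
    -- compares normal forms up to definitional equality.
    ℤ₂ : RawRing _ _
    ℤ₂ = record
      { Carrier = ℕ × ℕ
      ; _≈_     = _≡_
      ; _+_     = λ { (a , b) (c , d) → normalise (a ℕ.+ c , b ℕ.+ d) }
      ; _*_     = λ { (a , b) (c , d) → normalise (a ℕ.* c ℕ.+ b ℕ.* d , a ℕ.* d ℕ.+ b ℕ.* c) }
      ; -_      = λ { (a , b) → (b , a) }
      ; 0#      = (0 , 0)
      ; 1#      = (1 , 0)
      }

    -- ⟦ 0 , 0 ⟧ and ⟦ 1 , 0 ⟧ reduce to 0# and 1#, so the equations produced by solve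
    -- mention 0# and 1# themselves.
    ⟦_⟧ : ℕ × ℕ → Carrier
    ⟦ a , zero ⟧  = a · 1#
    ⟦ a , suc b ⟧ = a ⊝ suc b

    ⟦⟧≈⊝ : ∀ p → ⟦ p ⟧ ≈ uncurry _⊝_ p
    ⟦⟧≈⊝ (a , zero)  = begin
      a · 1#          ≈⟨ +-identityʳ (a · 1#) ⟨
      a · 1# + 0#     ≈⟨ +-congˡ -0#≈0# ⟨
      a ⊝ 0           ∎
    ⟦⟧≈⊝ (a , suc b) = refl

    ⊝-normalise : ∀ p → uncurry _⊝_ (normalise p) ≈ uncurry _⊝_ p
    ⊝-normalise (suc a , suc b) = trans (⊝-normalise (a , b)) (⊝-cong a b (suc a) (suc b) (ℕ.+-suc a b))
    ⊝-normalise (zero , b)      = refl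
    ⊝-normalise (suc a , zero)  = refl

    ⟦normalise⟧ : ∀ p → ⟦ normalise p ⟧ ≈ uncurry _⊝_ p
    ⟦normalise⟧ p = trans (⟦⟧≈⊝ (normalise p)) (⊝-normalise p)

    ⊝-homo-+ : ∀ a b c d → (a ℕ.+ c) ⊝ (b ℕ.+ d) ≈ a ⊝ b + c ⊝ d
    ⊝-homo-+ a b c d = begin
      (a ℕ.+ c) ⊝ (b ℕ.+ d)                   ≈⟨ +-cong (×-homo-+ 1# a c) (-‿cong (×-homo-+ 1# b d)) ⟩
      (a · 1# + c · 1#) - (b · 1# + d · 1#)   ≈⟨ -‿interchange _ _ _ _ ⟨
      a ⊝ b + c ⊝ d                           ∎

    ⊝-homo-* : ∀ a b c d → (a ℕ.* c ℕ.+ b ℕ.* d) ⊝ (a ℕ.* d ℕ.+ b ℕ.* c) ≈ a ⊝ b * c ⊝ d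
    ⊝-homo-* a b c d = begin
      (a ℕ.* c ℕ.+ b ℕ.* d) ⊝ (a ℕ.* d ℕ.+ b ℕ.* c)   ≈⟨ ⊝-homo-+ (a ℕ.* c) (a ℕ.* d) (b ℕ.* d) (b ℕ.* c) ⟩
      (a ℕ.* c) ⊝ (a ℕ.* d) + (b ℕ.* d) ⊝ (b ℕ.* c)   ≈⟨ +-cong (+-cong (×1-homo-* a c) (-‿cong (×1-homo-* a d)))
                                                                 (+-cong (×1-homo-* b d) (-‿cong (×1-homo-* b c))) ⟩
      (A * C - A * D) + (B * D - B * C)               ≈⟨ +-cong (x[y-z]≈xy-xz A C D) (⁻¹-anti-homo‿- (B * C) (B * D)) ⟨
      A * (C - D) - (B * C - B * D)                   ≈⟨ +-congˡ (-‿cong (x[y-z]≈xy-xz B C D)) ⟨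
      A * (C - D) - B * (C - D)                       ≈⟨ [y-z]x≈yx-zx (C - D) A B ⟨
      (A - B) * (C - D)                               ∎
      where
      A = a · 1#
      B = b · 1#
      C = c · 1#
      D = d · 1#

    homomorphism : ℤ₂ -Raw-AlmostCommutative⟶ fromCommutativeRing R
    homomorphism = record
      { ⟦_⟧    = ⟦_⟧
      ; +-homo = λ { (a , b) (c , d) → trans (⟦normalise⟧ (a ℕ.+ c , b ℕ.+ d))
                       (trans (⊝-homo-+ a b c d) (sym (+-cong (⟦⟧≈⊝ (a , b)) (⟦⟧≈⊝ (c , d))))) }
      ; *-homo = λ { (a , b) (c , d) → trans (⟦normalise⟧ (a ℕ.* c ℕ.+ b ℕ.* d , a ℕ.* d ℕ.+ b ℕ.* c))
                       (trans (⊝-homo-* a b c d) (sym (*-cong (⟦⟧≈⊝ (a , b)) (⟦⟧≈⊝ (c , d))))) }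
      ; -‿homo = λ { (a , b) → trans (⟦⟧≈⊝ (b , a))
                       (trans (sym (⁻¹-anti-homo‿- (a · 1#) (b · 1#))) (-‿cong (sym (⟦⟧≈⊝ (a , b))))) }
      ; 0-homo = refl
      ; 1-homo = refl
      }

    ⟦⟧-≟ : ∀ p q → Maybe (⟦ p ⟧ ≈ ⟦ q ⟧)
    ⟦⟧-≟ (a , b) (c , d) with a ℕ.+ d ℕ.≟ c ℕ.+ b
    ... | yes a+d≡c+b = just (trans (⟦⟧≈⊝ (a , b)) (trans (⊝-cong a b c d a+d≡c+b) (sym (⟦⟧≈⊝ (c , d)))))
    ... | no _        = nothing

  open import Algebra.Solver.Ring ℤ₂ (fromCommutativeRing R) homomorphism ⟦⟧-≟ public

  :0 :1 : ∀ {n} → Polynomial n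
  :0 = con (0 , 0)
  :1 = con (1 , 0)

module RingProperties {c ℓ} (R : Ring c ℓ) where
  open Ring R
  open import Algebra.Properties.Ring R using (x∙y⁻¹≈ε⇒x≈y; -‿injective; -0#≈0#)
  open import Relation.Binary.Reasoning.Setoid setoid

  modulo : ∀ {x y k z} → z ≈ 0# → x ≈ y + k * z → x ≈ y
  modulo {x} {y} {k} {z} z≈0 x≈y+kz = begin
    x           ≈⟨ x≈y+kz ⟩
    y + k * z   ≈⟨ +-congˡ (*-congˡ z≈0) ⟩
    y + k * 0#  ≈⟨ +-congˡ (zeroʳ k) ⟩
    y + 0#      ≈⟨ +-identityʳ y ⟩
    y           ∎

  x-y≉0 : ∀ {x y} → ¬ x ≈ y → ¬ x - y ≈ 0#
  x-y≉0 {x} {y} x≉y x-y≈0 = x≉y (x∙y⁻¹≈ε⇒x≈y x y x-y≈0)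

  -x≈0⇒x≈0 : ∀ {x} → - x ≈ 0# → x ≈ 0#
  -x≈0⇒x≈0 -x≈0 = -‿injective (trans -x≈0 (sym -0#≈0#))

pattern 0₅ = zero
pattern 1₅ = suc zero
pattern 2₅ = suc (suc zero)
pattern 3₅ = suc (suc (suc zero))
pattern 4₅ = suc (suc (suc (suc zero)))

sd₅ : 𝔽₅ → 𝔽₅ → 𝔽₅
sd₅ x y = (x +₅ y) /₅ (x -₅ y)

module _ {c ℓ} (F : Field c ℓ) where
  open Field F
  open import Algebra.Properties.Ring ring using (x∙y⁻¹≈ε⇒x≈y; x≈y⇒x∙y⁻¹≈ε)
  open IntegerCoefficients commutativeRing using (solve; _:=_; _:+_; _:*_; _:-_; :-_; :0; :1)
  open RingProperties ring
  open import Relation.Binary.Reasoning.Setoid setoid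

  ⁻¹-inverseˡ : ∀ x → ¬ x ≈ 0# → x ⁻¹ * x ≈ 1#
  ⁻¹-inverseˡ x x≉0 = trans (*-comm (x ⁻¹) x) (⁻¹-inverseʳ x x≉0)

  x≉0∧xy≈0⇒y≈0 : ∀ {x y} → ¬ x ≈ 0# → x * y ≈ 0# → y ≈ 0#
  x≉0∧xy≈0⇒y≈0 {x} {y} x≉0 xy≈0 = begin
    y                ≈⟨ *-identityˡ y ⟨
    1# * y           ≈⟨ *-congʳ (⁻¹-inverseˡ x x≉0) ⟨
    (x ⁻¹ * x) * y   ≈⟨ *-assoc (x ⁻¹) x y ⟩
    x ⁻¹ * (x * y)   ≈⟨ *-congˡ xy≈0 ⟩
    x ⁻¹ * 0#        ≈⟨ zeroʳ (x ⁻¹) ⟩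
    0#               ∎

  *≈⇒≈/ : ∀ {u v d} → ¬ d ≈ 0# → u * d ≈ v → u ≈ v / d
  *≈⇒≈/ {u} {v} {d} d≉0 ud≈v = begin
    u                ≈⟨ *-identityʳ u ⟨
    u * 1#           ≈⟨ *-congˡ (⁻¹-inverseʳ d d≉0) ⟨
    u * (d * d ⁻¹)   ≈⟨ *-assoc u d (d ⁻¹) ⟨
    (u * d) * d ⁻¹   ≈⟨ *-congʳ ud≈v ⟩
    v / d            ∎

  ≈/⇒*≈ : ∀ {u v d} → ¬ d ≈ 0# → u ≈ v / d → u * d ≈ v
  ≈/⇒*≈ {u} {v} {d} d≉0 u≈v/d = begin
    u * d            ≈⟨ *-congʳ u≈v/d ⟩
    (v * d ⁻¹) * d   ≈⟨ *-assoc v (d ⁻¹) d ⟩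
    v * (d ⁻¹ * d)   ≈⟨ *-congˡ (⁻¹-inverseˡ d d≉0) ⟩
    v * 1#           ≈⟨ *-identityʳ v ⟩
    v                ∎

  IsSqrtOfMinusOne : Carrier → Set ℓ
  IsSqrtOfMinusOne i = i * i + 1# ≈ 0#

  primitive4thRoot⇔sqrtOfMinusOne : ∀ ζ → IsPrimitive4thRoot F ζ ⇔ (IsSqrtOfMinusOne ζ × ¬ 1# + 1# ≈ 0#)
  primitive4thRoot⇔sqrtOfMinusOne ζ = mk⇔ to from
    where
    to : IsPrimitive4thRoot F ζ → IsSqrtOfMinusOne ζ × ¬ 1# + 1# ≈ 0#
    to (ζ⁴≈1 , ζᵏ≉1) = ζ²+1≈0 , 2≉0
      where
      ζ²≉1 : ¬ ζ ^ 2 ≈ 1#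
      ζ²≉1 = ζᵏ≉1 2 (s≤s z≤n) (s≤s (s≤s (s≤s z≤n)))
      ζ²+1≈0 : ζ * ζ + 1# ≈ 0#
      ζ²+1≈0 = x≉0∧xy≈0⇒y≈0 (x-y≉0 ζ²≉1) (modulo (x≈y⇒x∙y⁻¹≈ε ζ⁴≈1)
        (solve 1 (λ z → (z :* (z :* :1) :- :1) :* (z :* z :+ :1)
                      := :0 :+ :1 :* (z :* (z :* (z :* (z :* :1))) :- :1)) refl ζ))
      2≉0 : ¬ 1# + 1# ≈ 0#
      2≉0 2≈0 = ζ²≉1 (x∙y⁻¹≈ε⇒x≈y _ _ (modulo ζ²+1≈0 (modulo 2≈0
        (solve 1 (λ z → z :* (z :* :1) :- :1 := :0 :+ :1 :* (z :* z :+ :1) :+ (:- :1) :* (:1 :+ :1)) refl ζ))))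
    from : IsSqrtOfMinusOne ζ × ¬ 1# + 1# ≈ 0# → IsPrimitive4thRoot F ζ
    from (ζ²+1≈0 , 2≉0) = ζ⁴≈1 , ζᵏ≉1
      where
      ζ⁴≈1 : ζ ^ 4 ≈ 1#
      ζ⁴≈1 = modulo ζ²+1≈0 (solve 1 (λ z → z :* (z :* (z :* (z :* :1))) := :1 :+ (z :* z :- :1) :* (z :* z :+ :1)) refl ζ)
      ζᵏ≉1 : ∀ k → 0 ℕ.< k → k ℕ.< 4 → ¬ ζ ^ k ≈ 1#
      ζᵏ≉1 1 _ _ ζ≈1 = 2≉0 (modulo ζ²+1≈0 (modulo (x≈y⇒x∙y⁻¹≈ε ζ≈1)
        (solve 1 (λ z → :1 :+ :1 := :0 :+ :1 :* (z :* z :+ :1) :+ (:- (z :+ :1)) :* (z :* :1 :- :1)) refl ζ)))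
      ζᵏ≉1 2 _ _ ζ²≈1 = 2≉0 (modulo ζ²+1≈0 (modulo (x≈y⇒x∙y⁻¹≈ε ζ²≈1)
        (solve 1 (λ z → :1 :+ :1 := :0 :+ :1 :* (z :* z :+ :1) :+ (:- :1) :* (z :* (z :* :1) :- :1)) refl ζ)))
      ζᵏ≉1 3 _ _ ζ³≈1 = 2≉0 (modulo ζ²+1≈0 (modulo (x≈y⇒x∙y⁻¹≈ε ζ³≈1)
        (solve 1 (λ z → :1 :+ :1
                      := :0 :+ (:- (z :* z) :+ z :+ :1) :* (z :* z :+ :1) :+ (z :- :1) :* (z :* (z :* (z :* :1)) :- :1)) refl ζ)))
      ζᵏ≉1 (suc (suc (suc (suc _)))) _ (s≤s (s≤s (s≤s (s≤s ()))))

  ClearedSD : (𝔽₅ → Carrier) → Set ℓ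
  ClearedSD f = ∀ x y → x ≢ y → f (sd₅ x y) * (f x - f y) ≈ f x + f y

  isSDMap⇒clearedSD : ∀ {f} → IsSDMap F f → ClearedSD f
  isSDMap⇒clearedSD isSD x y x≢y with isSD x y x≢y
  ... | fx≉fy , sd = ≈/⇒*≈ (x-y≉0 fx≉fy) sd

  module _ {f : 𝔽₅ → Carrier} (isSD : IsSDMap F f) where
    private
      f₀ f₁ f₂ f₄ : Carrier
      f₀ = f 0₅
      f₁ = f 1₅
      f₂ = f 2₅
      f₄ = f 4₅

      sd≈0 : ∀ x y → x ≢ y → f (sd₅ x y) * (f x - f y) - (f x + f y) ≈ 0#
      sd≈0 x y x≢y = x≈y⇒x∙y⁻¹≈ε (isSDMap⇒clearedSD isSD x y x≢y)

      f≉ : ∀ x y → x ≢ y → ¬ f x - f y ≈ 0#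
      f≉ x y x≢y = x-y≉0 (proj₁ (isSD x y x≢y))

    sdMap-f1≈1 : f₁ - 1# ≈ 0#
    sdMap-f1≈1 = x≉0∧xy≈0⇒y≈0 (f≉ 1₅ 2₅ λ ()) (modulo (sd≈0 1₅ 0₅ λ ()) (modulo (sd≈0 2₅ 0₅ λ ())
      (solve 3 (λ a b c → (b :- c) :* (b :- :1)
                        := :0 :+ :1 :* (b :* (b :- a) :- (b :+ a)) :+ (:- :1) :* (b :* (c :- a) :- (c :+ a))) refl f₀ f₁ f₂)))

    sdMap-f2²≈-1 : IsSqrtOfMinusOne f₂
    sdMap-f2²≈-1 = modulo (sd≈0 1₅ 2₅ λ ()) (modulo sdMap-f1≈1
      (solve 2 (λ b c → c :* c :+ :1 := :0 :+ (:- :1) :* (c :* (b :- c) :- (b :+ c)) :+ (c :- :1) :* (b :- :1)) refl f₁ f₂))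

    sdMap-f4≈-f1 : f₄ + f₁ ≈ 0#
    sdMap-f4≈-f1 = x≉0∧xy≈0⇒y≈0 (f≉ 0₅ 1₅ λ ()) (modulo (sd≈0 0₅ 1₅ λ ()) (modulo (sd≈0 1₅ 0₅ λ ())
      (solve 3 (λ a b e → (a :- b) :* (e :+ b)
                        := :0 :+ :1 :* (e :* (a :- b) :- (a :+ b)) :+ (:- :1) :* (b :* (b :- a) :- (b :+ a))) refl f₀ f₁ f₄)))

    sdMap-2≉0 : ¬ 1# + 1# ≈ 0#
    sdMap-2≉0 2≈0 = f≉ 4₅ 1₅ (λ ()) (modulo sdMap-f4≈-f1 (modulo 2≈0
      (solve 2 (λ b e → e :- b := :0 :+ :1 :* (e :+ b) :+ (:- b) :* (:1 :+ :1)) refl f₁ f₄)))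

  clearedSD⇒isSDMap : ∀ {f} → ¬ 1# + 1# ≈ 0# → (∀ x → f x ≈ 0# → x ≡ 0₅) → ClearedSD f → IsSDMap F f
  clearedSD⇒isSDMap {f} 2≉0 f-vanishes-only-at-0 cleared x y x≢y = fx≉fy , *≈⇒≈/ (x-y≉0 fx≉fy) (cleared x y x≢y)
    where
    fx≉fy : ¬ f x ≈ f y
    fx≉fy fx≈fy = x≢y (≡.trans (f-vanishes-only-at-0 x fx≈0) (≡.sym (f-vanishes-only-at-0 y (trans (sym fx≈fy) fx≈0))))
      where
      fx≈0 : f x ≈ 0#
      fx≈0 = x≉0∧xy≈0⇒y≈0 2≉0 (begin
        (1# + 1#) * f x             ≈⟨ solve 1 (λ u → (:1 :+ :1) :* u := u :+ u) refl (f x) ⟩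
        f x + f x                   ≈⟨ +-congˡ fx≈fy ⟩
        f x + f y                   ≈⟨ cleared x y x≢y ⟨
        f (sd₅ x y) * (f x - f y)   ≈⟨ *-congˡ (x≈y⇒x∙y⁻¹≈ε fx≈fy) ⟩
        f (sd₅ x y) * 0#            ≈⟨ zeroʳ _ ⟩
        0#                          ∎)

  -- 2 generates 𝔽₅ˣ, and quarticCharacter i (2 ^ k) = i ^ k.
  quarticCharacter : Carrier → 𝔽₅ → Carrier
  quarticCharacter i 0₅ = 0#
  quarticCharacter i 1₅ = 1#
  quarticCharacter i 2₅ = i
  quarticCharacter i 3₅ = - i
  quarticCharacter i 4₅ = - 1#

  module _ {i : Carrier} (i²≈-1 : IsSqrtOfMinusOne i) (2≉0 : ¬ 1# + 1# ≈ 0#) where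
    private
      i≉0 : ¬ i ≈ 0#
      i≉0 i≈0 = 0≉1 (sym (modulo i²≈-1 (modulo i≈0
        (solve 1 (λ z → :1 := :0 :+ :1 :* (z :* z :+ :1) :+ (:- z) :* z) refl i))))

      at-y≡0 : ∀ t → 1# * (t - 0#) ≈ t + 0#
      at-y≡0 = solve 1 (λ t → :1 :* (t :- :0) := t :+ :0) refl
      at-x≡0 : ∀ t → - 1# * (0# - t) ≈ 0# + t
      at-x≡0 = solve 1 (λ t → (:- :1) :* (:0 :- t) := :0 :+ t) refl
      at-y≡-x : ∀ t → 0# * (t - - t) ≈ t + - t
      at-y≡-x = solve 1 (λ t → :0 :* (t :- :- t) := t :+ :- t) refl
      at-x≡-y : ∀ t → 0# * (- t - t) ≈ - t + t
      at-x≡-y = solve 1 (λ t → :0 :* (:- t :- t) := :- t :+ t) refl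

    quarticCharacter-vanishes-only-at-0 : ∀ x → quarticCharacter i x ≈ 0# → x ≡ 0₅
    quarticCharacter-vanishes-only-at-0 0₅ _     = ≡.refl
    quarticCharacter-vanishes-only-at-0 1₅ 1≈0   = contradiction (sym 1≈0) 0≉1
    quarticCharacter-vanishes-only-at-0 2₅ i≈0   = contradiction i≈0 i≉0
    quarticCharacter-vanishes-only-at-0 3₅ -i≈0  = contradiction (-x≈0⇒x≈0 -i≈0) i≉0
    quarticCharacter-vanishes-only-at-0 4₅ -1≈0  = contradiction (sym (-x≈0⇒x≈0 -1≈0)) 0≉1

    quarticCharacter-clearedSD : ClearedSD (quarticCharacter i)
    quarticCharacter-clearedSD 0₅ 0₅ x≢x = contradiction ≡.refl x≢x
    quarticCharacter-clearedSD 1₅ 1₅ x≢x = contradiction ≡.refl x≢x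
    quarticCharacter-clearedSD 2₅ 2₅ x≢x = contradiction ≡.refl x≢x
    quarticCharacter-clearedSD 3₅ 3₅ x≢x = contradiction ≡.refl x≢x
    quarticCharacter-clearedSD 4₅ 4₅ x≢x = contradiction ≡.refl x≢x
    quarticCharacter-clearedSD 1₅ 0₅ _ = at-y≡0 _
    quarticCharacter-clearedSD 2₅ 0₅ _ = at-y≡0 _
    quarticCharacter-clearedSD 3₅ 0₅ _ = at-y≡0 _
    quarticCharacter-clearedSD 4₅ 0₅ _ = at-y≡0 _
    quarticCharacter-clearedSD 0₅ 1₅ _ = at-x≡0 _
    quarticCharacter-clearedSD 0₅ 2₅ _ = at-x≡0 _
    quarticCharacter-clearedSD 0₅ 3₅ _ = at-x≡0 _
    quarticCharacter-clearedSD 0₅ 4₅ _ = at-x≡0 _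
    quarticCharacter-clearedSD 1₅ 4₅ _ = at-y≡-x 1#
    quarticCharacter-clearedSD 2₅ 3₅ _ = at-y≡-x i
    quarticCharacter-clearedSD 4₅ 1₅ _ = at-x≡-y 1#
    quarticCharacter-clearedSD 3₅ 2₅ _ = at-x≡-y i
    quarticCharacter-clearedSD 1₅ 2₅ _ = modulo i²≈-1
      (solve 1 (λ z → z :* (:1 :- z) := (:1 :+ z) :+ (:- :1) :* (z :* z :+ :1)) refl i)
    quarticCharacter-clearedSD 1₅ 3₅ _ = modulo i²≈-1
      (solve 1 (λ z → (:- z) :* (:1 :- :- z) := (:1 :+ :- z) :+ (:- :1) :* (z :* z :+ :1)) refl i)
    quarticCharacter-clearedSD 2₅ 1₅ _ = modulo i²≈-1
      (solve 1 (λ z → (:- z) :* (z :- :1) := (z :+ :1) :+ (:- :1) :* (z :* z :+ :1)) refl i)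
    quarticCharacter-clearedSD 2₅ 4₅ _ = modulo i²≈-1
      (solve 1 (λ z → z :* (z :- :- :1) := (z :+ :- :1) :+ :1 :* (z :* z :+ :1)) refl i)
    quarticCharacter-clearedSD 3₅ 1₅ _ = modulo i²≈-1
      (solve 1 (λ z → z :* (:- z :- :1) := (:- z :+ :1) :+ (:- :1) :* (z :* z :+ :1)) refl i)
    quarticCharacter-clearedSD 3₅ 4₅ _ = modulo i²≈-1
      (solve 1 (λ z → (:- z) :* (:- z :- :- :1) := (:- z :+ :- :1) :+ :1 :* (z :* z :+ :1)) refl i)
    quarticCharacter-clearedSD 4₅ 2₅ _ = modulo i²≈-1
      (solve 1 (λ z → (:- z) :* (:- :1 :- z) := (:- :1 :+ z) :+ :1 :* (z :* z :+ :1)) refl i)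
    quarticCharacter-clearedSD 4₅ 3₅ _ = modulo i²≈-1
      (solve 1 (λ z → z :* (:- :1 :- :- z) := (:- :1 :+ :- z) :+ :1 :* (z :* z :+ :1)) refl i)

    quarticCharacter-isSDMap : IsSDMap F (quarticCharacter i)
    quarticCharacter-isSDMap =
      clearedSD⇒isSDMap 2≉0 quarticCharacter-vanishes-only-at-0 quarticCharacter-clearedSD

  sdMap⇒primitive4thRoot : HasSDMap F → HasPrimitive4thRoot F
  sdMap⇒primitive4thRoot (f , isSD) =
    f 2₅ , Equivalence.from (primitive4thRoot⇔sqrtOfMinusOne (f 2₅)) (sdMap-f2²≈-1 isSD , sdMap-2≉0 isSD)

  primitive4thRoot⇒sdMap : HasPrimitive4thRoot F → HasSDMap F
  primitive4thRoot⇒sdMap (ζ , isPrimitive) with Equivalence.to (primitive4thRoot⇔sqrtOfMinusOne ζ) isPrimitive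
  ... | ζ²≈-1 , 2≉0 = quarticCharacter ζ , quarticCharacter-isSDMap ζ²≈-1 2≉0

proposition2p3 : ∀ {c ℓ} (F : Field c ℓ) → HasSDMap F ⇔ HasPrimitive4thRoot F
proposition2p3 F = mk⇔ (sdMap⇒primitive4thRoot F) (primitive4thRoot⇒sdMap F)
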